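{- If $h \ge 1$, then $\mu_t(Q_h) = 2\alpha(Q_h')$.
   Context: $Q_h$ is the hypercube with vertex set $\{0,1\}^h$, two strings adjacent iff they differ in exactly one position. For $M \subseteq V(G)$, a $u,v$-path is $M$-free if it contains no vertex of $M\setminus\{u,v\}$; $u,v$ are $M$-visible if there is an $M$-free shortest $u,v$-path. $M$ is a total mutual-visibility set if every $u,v\in V(G)$ are $M$-visible, and $\mu_t(G)$ is the maximum size of such a set. The halved cube $Q_h'$ is the graph whose vertices are the binary strings of length $h$ with an even number of ones, two of them adjacent iff their distance in $Q_h$ is $2$ (the analogous graph on odd-weight strings is isomorphic to it). $\alpha(G)$ is the independence number of $G$. -}

module Defs where

open import Data.Nat using (ℕ; zero; suc; _+_; _≤_; _%_)
open import Data.Bool using (Bool; true; false; _xor_)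
open import Data.Vec using (Vec; []; _∷_; zipWith; count)
open import Data.List using (List; length)
open import Data.List.Membership.Propositional using (_∈_)
open import Data.List.Relation.Unary.Unique.Propositional using (Unique)
open import Data.Product using (Σ; _×_; _,_)
open import Data.Sum using (_⊎_)
open import Relation.Nullary using (¬_)
open import Relation.Binary.PropositionalEquality using (_≡_)
open import Data.Bool.Properties using () renaming (T? to T?)

record Graph : Set₁ where
  field
    V   : Set
    Adj : V → V → Set

module _ (G : Graph) where
  open Graph G

  data Walk : V → V → Set where
    []  : ∀ {u} → Walk u u
    _∷_ : ∀ {u w v} → Adj u w → Walk w v → Walk u v

  walkLength : ∀ {u v} → Walk u v → ℕ
  walkLength []      = 0
  walkLength (_ ∷ p) = suc (walkLength p)

  -- x is a vertex of the walk other than its first and last vertex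
  data Internal : ∀ {u v} → V → Walk u v → Set where
    here  : ∀ {u w v v'} (a : Adj u w) (b : Adj w v) (p : Walk v v') → Internal w (a ∷ (b ∷ p))
    there : ∀ {x u w v} (a : Adj u w) (p : Walk w v) → Internal x p → Internal x (a ∷ p)

  IsShortest : ∀ {u v} → Walk u v → Set
  IsShortest {u} {v} p = ∀ (q : Walk u v) → walkLength p ≤ walkLength q

  Dist : V → V → ℕ → Set
  Dist u v n = Σ (Walk u v) λ p → IsShortest p × walkLength p ≡ n

  MFree : List V → ∀ {u v} → Walk u v → Set
  MFree M {u} {v} p = ∀ x → Internal x p → x ∈ M → (x ≡ u ⊎ x ≡ v)

  MVisible : List V → V → V → Set
  MVisible M u v = Σ (Walk u v) λ p → IsShortest p × MFree M p

  -- total mutual-visibility set (a set = duplicate-free list)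
  IsTotalMVSet : List V → Set
  IsTotalMVSet M = Unique M × (∀ u v → MVisible M u v)

  IsIndependent : List V → Set
  IsIndependent S = Unique S × (∀ x y → x ∈ S → y ∈ S → ¬ Adj x y)

IsMaxSize : {A : Set} → (List A → Set) → ℕ → Set
IsMaxSize {A} P n = Σ (List A) (λ S → P S × length S ≡ n) × (∀ S → P S → length S ≤ n)

hamming : ∀ {h} → Vec Bool h → Vec Bool h → ℕ
hamming x y = count T? (zipWith _xor_ x y)

weight : ∀ {h} → Vec Bool h → ℕ
weight x = count T? x

Q : ℕ → Graph
Q h = record { V = Vec Bool h ; Adj = λ x y → hamming x y ≡ 1 }

Q' : ℕ → Graph
Q' h = record
  { V   = Σ (Vec Bool h) (λ x → weight x % 2 ≡ 0)
  ; Adj = λ x y → Dist (Q h) (Data.Product.proj₁ x) (Data.Product.proj₁ y) 2 }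

IsMuT : (G : Graph) → ℕ → Set
IsMuT G n = IsMaxSize (IsTotalMVSet G) n

IsAlpha : (G : Graph) → ℕ → Set
IsAlpha G n = IsMaxSize (IsIndependent G) n

{-# OPTIONS --safe #-}
module Submission where

-- A set M ⊆ V(Q_h) is a total mutual-visibility set exactly when no two of its
-- vertices are at distance 2.  If x, y ∈ M are at distance 2, they are opposite
-- corners of a 4-cycle whose other two corners u, v have no common neighbour
-- besides x and y, so every shortest u,v-path runs through M.  Conversely, if M
-- has no such pair, a shortest path can be grown step by step around M: a vertex
-- at distance ≥ 2 from the target has two possible next steps, which are at
-- distance 2 from each other and hence not both in M.
--
-- Vertices at distance 2 have weights of the same parity.  So such an M splits
-- into its even part and its odd part; the even part, and the odd part with its
-- first bit flipped, are independent sets of Q'_h, whence |M| ≤ 2 α(Q'_h).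
-- Conversely, a maximum independent set of Q'_h together with its first-bit flip
-- has no pair at distance 2 and size 2 α(Q'_h).

open import Defs
open import Data.Bool using (Bool; true; false; not)
import Data.Bool.Properties as Bool
open import Data.Empty using (⊥; ⊥-elim)
open import Data.List using (List; []; _∷_; [_]; map; _++_; length; filter; cartesianProductWith)
open import Data.List.Extrema.Nat using (argmax; argmax-all; f[xs]≤f[argmax])
open import Data.List.Membership.Propositional using (_∈_; _∉_)
open import Data.List.Membership.Propositional.Properties
  using (∈-map⁺; ∈-map⁻; ∈-++⁺ˡ; ∈-++⁺ʳ; ∈-++⁻; ∈-filter⁺; ∈-filter⁻; ∈-cartesianProductWith⁺)
open import Data.List.Membership.Propositional.Properties.WithK using (unique∧set⇒bag)
import Data.List.Membership.DecPropositional as DecMembership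
open import Data.List.Properties using (length-map; length-++)
open import Data.List.Relation.Binary.BagAndSetEquality using (∼bag⇒↭)
open import Data.List.Relation.Binary.Disjoint.Propositional using (Disjoint)
open import Data.List.Relation.Binary.Permutation.Propositional.Properties using (↭-length)
open import Data.List.Relation.Binary.Subset.Propositional using (_⊆_)
open import Data.List.Relation.Binary.Subset.Propositional.Properties using (filter-⊆)
open import Data.List.Relation.Unary.All as All using (All; all?)
import Data.List.Relation.Unary.All.Properties as All
open import Data.List.Relation.Unary.Any using (here; there)
open import Data.List.Relation.Unary.Unique.Propositional using (Unique; []; _∷_)
import Data.List.Relation.Unary.Unique.Propositional.Properties as Unique
open import Data.List.Relation.Unary.Unique.DecPropositional using (unique?)
open import Data.Nat using (ℕ; zero; suc; _+_; _*_; _≤_; _%_; _≟_; z≤n; s≤s; parity)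
open import Data.Nat.Properties
  using (suc-injective; +-suc; +-identityʳ; +-mono-≤; n≤1+n; ≤-trans; ≤-reflexive; ≤-antisym;
         ≡-irrelevant; module ≤-Reasoning)
open import Data.Parity.Base using (0ℙ; 1ℙ; _⁻¹) renaming (_+_ to _⊕_)
open import Data.Parity.Properties using (suc-homo-⁻¹; ⁻¹-selfInverse; +-homo-+)
open import Data.Product using (Σ; ∃₂; _×_; _,_; proj₁; proj₂)
open import Data.Sum using (_⊎_; inj₁; inj₂)
import Data.Sum as Sum
open import Data.Vec using (Vec; []; _∷_)
open import Data.Vec.Properties using (≡-dec; ∷-injective)
open import Function using (_∘_; mk⇔)
open import Relation.Binary.Definitions using (DecidableEquality)
open import Relation.Binary.PropositionalEquality
  using (_≡_; _≢_; refl; sym; trans; cong; cong₂; subst; subst₂; module ≡-Reasoning)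
open import Relation.Nullary using (¬_; Dec; yes; no; does; ¬?; contradiction)
open import Relation.Nullary.Decidable using (map′; _×-dec_)
open import Relation.Unary using (Decidable)
open import Relation.Unary.Properties using (∁?)

private
  variable
    h k n : ℕ

sublists : {A : Set} → List A → List (List A)
sublists []       = [ [] ]
sublists (x ∷ xs) = map (x ∷_) (sublists xs) ++ sublists xs

filter∈sublists : {A : Set} {P : A → Set} (P? : Decidable P) (xs : List A) → filter P? xs ∈ sublists xs
filter∈sublists P? []       = here refl
filter∈sublists P? (x ∷ xs) with does (P? x)
... | true  = ∈-++⁺ˡ (∈-map⁺ (x ∷_) (filter∈sublists P? xs))
... | false = ∈-++⁺ʳ (map (x ∷_) (sublists xs)) (filter∈sublists P? xs)

length-filter+length-filter-∁ : {A : Set} {P : A → Set} (P? : Decidable P) (xs : List A) →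
                                length (filter P? xs) + length (filter (∁? P?) xs) ≡ length xs
length-filter+length-filter-∁ P? []       = refl
length-filter+length-filter-∁ P? (x ∷ xs) with does (P? x)
... | true  = cong suc (length-filter+length-filter-∁ P? xs)
... | false = trans (+-suc _ _) (cong suc (length-filter+length-filter-∁ P? xs))

module _ {A : Set} (_≟ᴬ_ : DecidableEquality A) {universe : List A}
         (complete : ∀ x → x ∈ universe) (universe-unique : Unique universe) where

  open DecMembership _≟ᴬ_ using (_∈?_)

  relist : List A → List A
  relist S = filter (_∈? S) universe

  relist⊆ : (S : List A) → relist S ⊆ S
  relist⊆ S = proj₂ ∘ ∈-filter⁻ (_∈? S) {xs = universe}

  relist-unique : (S : List A) → Unique (relist S)
  relist-unique S = Unique.filter⁺ (_∈? S) universe-unique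

  length-relist : {S : List A} → Unique S → length S ≡ length (relist S)
  length-relist {S} S-unique = ↭-length (∼bag⇒↭ (unique∧set⇒bag S-unique (relist-unique S)
    (mk⇔ (∈-filter⁺ (_∈? S) (complete _)) (relist⊆ S))))

  -- Relisting an admissible S in the order of the universe keeps it admissible
  -- and of the same length, so the longest admissible sublist of the universe
  -- is a largest admissible list overall.
  maxSize : {P : List A → Set} → Decidable P → P [] →
            (∀ {S T} → Unique T → T ⊆ S → P S → P T) → (∀ {S} → P S → Unique S) →
            Σ ℕ (IsMaxSize P)
  maxSize {P} P? P[] hereditary P⇒unique = length largest , (largest , P-largest , refl) , bounded
    where
    candidates : List (List A)
    candidates = filter P? (sublists universe)

    largest : List A
    largest = argmax length [] candidates

    P-largest : P largest
    P-largest = argmax-all length P[] (All.tabulate (proj₂ ∘ ∈-filter⁻ P? {xs = sublists universe}))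

    bounded : ∀ S → P S → length S ≤ length largest
    bounded S PS = begin
      length S          ≡⟨ length-relist (P⇒unique PS) ⟩
      length (relist S) ≤⟨ All.lookup (f[xs]≤f[argmax] {f = length} [] candidates) relist-candidate ⟩
      length largest    ∎
      where
      open ≤-Reasoning
      relist-candidate : relist S ∈ candidates
      relist-candidate = ∈-filter⁺ P? (filter∈sublists (_∈? S) universe)
                                      (hereditary (relist-unique S) (relist⊆ S) PS)

hamming-refl : (x : Vec Bool h) → hamming x x ≡ 0
hamming-refl []          = refl
hamming-refl (true ∷ x)  = hamming-refl x
hamming-refl (false ∷ x) = hamming-refl x

hamming≡0⇒≡ : (x y : Vec Bool h) → hamming x y ≡ 0 → x ≡ y
hamming≡0⇒≡ []          []          _ = refl
hamming≡0⇒≡ (true ∷ x)  (true ∷ y)  d = cong (true ∷_) (hamming≡0⇒≡ x y d)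
hamming≡0⇒≡ (false ∷ x) (false ∷ y) d = cong (false ∷_) (hamming≡0⇒≡ x y d)

hamming-sym : (x y : Vec Bool h) → hamming x y ≡ hamming y x
hamming-sym []          []          = refl
hamming-sym (true ∷ x)  (true ∷ y)  = hamming-sym x y
hamming-sym (true ∷ x)  (false ∷ y) = cong suc (hamming-sym x y)
hamming-sym (false ∷ x) (true ∷ y)  = cong suc (hamming-sym x y)
hamming-sym (false ∷ x) (false ∷ y) = hamming-sym x y

private
  ≤-suc-right : ∀ {l m n} → l ≤ m + n → suc l ≤ m + suc n
  ≤-suc-right {m = m} {n} l≤m+n rewrite +-suc m n = s≤s l≤m+n

  ≤-suc-both : ∀ {l m n} → l ≤ m + n → l ≤ suc m + suc n
  ≤-suc-both {m = m} {n} l≤m+n = ≤-trans l≤m+n (+-mono-≤ (n≤1+n m) (n≤1+n n))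

hamming-triangle : (x y z : Vec Bool h) → hamming x z ≤ hamming x y + hamming y z
hamming-triangle []          []          []          = z≤n
hamming-triangle (true ∷ x)  (true ∷ y)  (true ∷ z)  = hamming-triangle x y z
hamming-triangle (true ∷ x)  (true ∷ y)  (false ∷ z) = ≤-suc-right (hamming-triangle x y z)
hamming-triangle (true ∷ x)  (false ∷ y) (true ∷ z)  = ≤-suc-both (hamming-triangle x y z)
hamming-triangle (true ∷ x)  (false ∷ y) (false ∷ z) = s≤s (hamming-triangle x y z)
hamming-triangle (false ∷ x) (true ∷ y)  (true ∷ z)  = s≤s (hamming-triangle x y z)
hamming-triangle (false ∷ x) (true ∷ y)  (false ∷ z) = ≤-suc-both (hamming-triangle x y z)
hamming-triangle (false ∷ x) (false ∷ y) (true ∷ z)  = ≤-suc-right (hamming-triangle x y z)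
hamming-triangle (false ∷ x) (false ∷ y) (false ∷ z) = hamming-triangle x y z

step-towards : (u v : Vec Bool h) → hamming u v ≡ suc k →
               Σ (Vec Bool h) λ w → hamming u w ≡ 1 × hamming w v ≡ k
step-towards [] [] ()
step-towards (true ∷ u) (true ∷ v) d with step-towards u v d
... | w , u-w , w-v = true ∷ w , u-w , w-v
step-towards (false ∷ u) (false ∷ v) d with step-towards u v d
... | w , u-w , w-v = false ∷ w , u-w , w-v
step-towards (true ∷ u)  (false ∷ v) d = false ∷ u , cong suc (hamming-refl u) , suc-injective d
step-towards (false ∷ u) (true ∷ v)  d = true ∷ u , cong suc (hamming-refl u) , suc-injective d

two-steps-towards : (u v : Vec Bool h) → hamming u v ≡ suc (suc k) →
  ∃₂ λ w₁ w₂ → (hamming u w₁ ≡ 1 × hamming w₁ v ≡ suc k)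
             × (hamming u w₂ ≡ 1 × hamming w₂ v ≡ suc k)
             × hamming w₁ w₂ ≡ 2
two-steps-towards [] [] ()
two-steps-towards (true ∷ u) (true ∷ v) d with two-steps-towards u v d
... | w₁ , w₂ , step₁ , step₂ , w₁-w₂ = true ∷ w₁ , true ∷ w₂ , step₁ , step₂ , w₁-w₂
two-steps-towards (false ∷ u) (false ∷ v) d with two-steps-towards u v d
... | w₁ , w₂ , step₁ , step₂ , w₁-w₂ = false ∷ w₁ , false ∷ w₂ , step₁ , step₂ , w₁-w₂
two-steps-towards (true ∷ u) (false ∷ v) d with step-towards u v (suc-injective d)
... | w , u-w , w-v =
  false ∷ u , true ∷ w , (cong suc (hamming-refl u) , suc-injective d) , (u-w , cong suc w-v) , cong suc u-w
two-steps-towards (false ∷ u) (true ∷ v) d with step-towards u v (suc-injective d)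
... | w , u-w , w-v =
  true ∷ u , false ∷ w , (cong suc (hamming-refl u) , suc-injective d) , (u-w , cong suc w-v) , cong suc u-w

private
  suc≡1⇒≡0 : suc n ≡ 1 → n ≡ 0
  suc≡1⇒≡0 refl = refl

  hamming≡2⇒no-midpoint : (u w v : Vec Bool h) → hamming u v ≡ 2 →
                          hamming u w ≡ 0 → hamming w v ≡ 0 → ⊥
  hamming≡2⇒no-midpoint u w v u-v u-w w-v =
    contradiction (subst₂ _≤_ u-v (cong₂ _+_ u-w w-v) (hamming-triangle u w v)) λ ()

other-diagonal : (x y : Vec Bool h) → hamming x y ≡ 2 →
  ∃₂ λ u v → hamming u v ≡ 2 × (∀ w → hamming u w ≡ 1 → hamming w v ≡ 1 → w ≡ x ⊎ w ≡ y)
other-diagonal [] [] ()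
other-diagonal (true ∷ x) (true ∷ y) d with other-diagonal x y d
... | u , v , u-v , common = true ∷ u , true ∷ v , u-v , λ where
  (true ∷ w)  u-w w-v → Sum.map (cong (true ∷_)) (cong (true ∷_)) (common w u-w w-v)
  (false ∷ w) u-w w-v → ⊥-elim (hamming≡2⇒no-midpoint u w v u-v (suc≡1⇒≡0 u-w) (suc≡1⇒≡0 w-v))
other-diagonal (false ∷ x) (false ∷ y) d with other-diagonal x y d
... | u , v , u-v , common = false ∷ u , false ∷ v , u-v , λ where
  (false ∷ w) u-w w-v → Sum.map (cong (false ∷_)) (cong (false ∷_)) (common w u-w w-v)
  (true ∷ w)  u-w w-v → ⊥-elim (hamming≡2⇒no-midpoint u w v u-v (suc≡1⇒≡0 u-w) (suc≡1⇒≡0 w-v))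
other-diagonal (true ∷ x) (false ∷ y) d =
  true ∷ y , false ∷ x , cong suc (trans (hamming-sym y x) (suc-injective d)) , λ where
  (true ∷ w)  y-w w-x → inj₁ (cong (true ∷_) (hamming≡0⇒≡ w x (suc≡1⇒≡0 w-x)))
  (false ∷ w) y-w w-x → inj₂ (cong (false ∷_) (sym (hamming≡0⇒≡ y w (suc≡1⇒≡0 y-w))))
other-diagonal (false ∷ x) (true ∷ y) d =
  false ∷ y , true ∷ x , cong suc (trans (hamming-sym y x) (suc-injective d)) , λ where
  (false ∷ w) y-w w-x → inj₁ (cong (false ∷_) (hamming≡0⇒≡ w x (suc≡1⇒≡0 w-x)))
  (true ∷ w)  y-w w-x → inj₂ (cong (true ∷_) (sym (hamming≡0⇒≡ y w (suc≡1⇒≡0 y-w))))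

flipHead : Vec Bool (suc h) → Vec Bool (suc h)
flipHead (b ∷ x) = not b ∷ x

flipHead-involutive : (x : Vec Bool (suc h)) → flipHead (flipHead x) ≡ x
flipHead-involutive (true ∷ x)  = refl
flipHead-involutive (false ∷ x) = refl

flipHead-injective : {x y : Vec Bool (suc h)} → flipHead x ≡ flipHead y → x ≡ y
flipHead-injective {x = x} {y} fx≡fy =
  trans (sym (flipHead-involutive x)) (trans (cong flipHead fx≡fy) (flipHead-involutive y))

hamming-flipHead : (x y : Vec Bool (suc h)) → hamming (flipHead x) (flipHead y) ≡ hamming x y
hamming-flipHead (true ∷ x)  (true ∷ y)  = refl
hamming-flipHead (true ∷ x)  (false ∷ y) = refl
hamming-flipHead (false ∷ x) (true ∷ y)  = refl
hamming-flipHead (false ∷ x) (false ∷ y) = refl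

Even : Vec Bool h → Set
Even x = weight x % 2 ≡ 0

Even? : (x : Vec Bool h) → Dec (Even x)
Even? x = weight x % 2 ≟ 0

%2≡0⇒parity≡0ℙ : ∀ n → n % 2 ≡ 0 → parity n ≡ 0ℙ
%2≡0⇒parity≡0ℙ zero          _    = refl
%2≡0⇒parity≡0ℙ (suc (suc n)) even = %2≡0⇒parity≡0ℙ n even

parity≡0ℙ⇒%2≡0 : ∀ n → parity n ≡ 0ℙ → n % 2 ≡ 0
parity≡0ℙ⇒%2≡0 zero          _    = refl
parity≡0ℙ⇒%2≡0 (suc (suc n)) even = parity≡0ℙ⇒%2≡0 n even

parity-suc : ∀ n → parity (suc n) ≡ parity n ⁻¹
parity-suc n = sym (⁻¹-selfInverse (suc-homo-⁻¹ n))

parity-cong-suc : ∀ m n → parity m ≡ parity n → parity (suc m) ≡ parity (suc n)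
parity-cong-suc m n eq = trans (parity-suc m) (trans (cong _⁻¹ eq) (sym (parity-suc n)))

parity-hamming : (x y : Vec Bool h) → parity (hamming x y) ≡ parity (weight x + weight y)
parity-hamming []          []          = refl
parity-hamming (true ∷ x)  (true ∷ y)  rewrite +-suc (weight x) (weight y) = parity-hamming x y
parity-hamming (true ∷ x)  (false ∷ y) =
  parity-cong-suc (hamming x y) (weight x + weight y) (parity-hamming x y)
parity-hamming (false ∷ x) (true ∷ y)  rewrite +-suc (weight x) (weight y) =
  parity-cong-suc (hamming x y) (weight x + weight y) (parity-hamming x y)
parity-hamming (false ∷ x) (false ∷ y) = parity-hamming x y

hamming≡2⇒Even : (x y : Vec Bool h) → hamming x y ≡ 2 → Even x → Even y
hamming≡2⇒Even x y x-y even-x = parity≡0ℙ⇒%2≡0 (weight y) (begin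
  parity (weight y)                       ≡⟨ cong (_⊕ parity (weight y)) (%2≡0⇒parity≡0ℙ (weight x) even-x) ⟨
  parity (weight x) ⊕ parity (weight y)   ≡⟨ +-homo-+ (weight x) (weight y) ⟨
  parity (weight x + weight y)            ≡⟨ parity-hamming x y ⟨
  parity (hamming x y)                    ≡⟨ cong parity x-y ⟩
  0ℙ                                      ∎)
  where open ≡-Reasoning

parity-flipHead : (x : Vec Bool (suc h)) → parity (weight (flipHead x)) ≡ parity (weight x) ⁻¹
parity-flipHead (true ∷ x)  = sym (suc-homo-⁻¹ (weight x))
parity-flipHead (false ∷ x) = parity-suc (weight x)

Even⇒¬Even-flipHead : {x : Vec Bool (suc h)} → Even x → ¬ Even (flipHead x)
Even⇒¬Even-flipHead {x = x} even-x even-fx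
  with trans (sym (%2≡0⇒parity≡0ℙ (weight (flipHead x)) even-fx))
             (trans (parity-flipHead x) (cong _⁻¹ (%2≡0⇒parity≡0ℙ (weight x) even-x)))
... | ()

¬Even⇒Even-flipHead : {x : Vec Bool (suc h)} → ¬ Even x → Even (flipHead x)
¬Even⇒Even-flipHead {x = x} odd-x with parity (weight x) in parity≡ | parity-flipHead x
... | 0ℙ | _            = contradiction (parity≡0ℙ⇒%2≡0 (weight x) parity≡) odd-x
... | 1ℙ | parity-flip≡ = parity≡0ℙ⇒%2≡0 (weight (flipHead x)) parity-flip≡

module _ (G : Graph) (M : List (Graph.V G)) where
  open Graph G

  FreeWalk : V → V → ℕ → Set
  FreeWalk u v k = Σ (Walk G u v) λ p → walkLength G p ≡ k × MFree G M p

  FreeWalk-∷ : ∀ {u w v} → Adj u w → w ∉ M → FreeWalk w v k → FreeWalk u v (suc k)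
  FreeWalk-∷ u-w w∉M (p , length≡ , p-free) = u-w ∷ p , cong suc length≡ , free
    where
    free : MFree G M (u-w ∷ p)
    free x (here _ _ _)  x∈M = contradiction x∈M w∉M
    free x (there _ _ i) x∈M with p-free x i x∈M
    ... | inj₁ refl = contradiction x∈M w∉M
    ... | inj₂ x≡v  = inj₂ x≡v

Hamming2Free : List (Vec Bool h) → Set
Hamming2Free M = ∀ {x y} → x ∈ M → y ∈ M → hamming x y ≢ 2

Hamming2Free? : (xs : List (Vec Bool h)) → Dec (Hamming2Free xs)
Hamming2Free? xs = map′
  (λ all x∈xs y∈xs → All.lookup (All.lookup all x∈xs) y∈xs)
  (λ free → All.tabulate λ x∈xs → All.tabulate λ y∈xs → free x∈xs y∈xs)
  (all? (λ x → all? (λ y → ¬? (hamming x y ≟ 2)) xs) xs)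

Hamming2Free-⊆ : {xs ys : List (Vec Bool h)} → ys ⊆ xs → Hamming2Free xs → Hamming2Free ys
Hamming2Free-⊆ ys⊆xs xs-free x∈ys y∈ys = xs-free (ys⊆xs x∈ys) (ys⊆xs y∈ys)

Hamming2Free-map : {f : Vec Bool h → Vec Bool h} → (∀ x y → hamming (f x) (f y) ≡ hamming x y) →
                   {xs : List (Vec Bool h)} → Hamming2Free xs → Hamming2Free (map f xs)
Hamming2Free-map {f = f} isometry xs-free fx∈ fy∈ with ∈-map⁻ f fx∈ | ∈-map⁻ f fy∈
... | x , x∈xs , refl | y , y∈xs , refl = xs-free x∈xs y∈xs ∘ trans (sym (isometry x y))

Hamming2Free-++ : {xs ys : List (Vec Bool h)} → All Even xs → All (¬_ ∘ Even) ys →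
                  Hamming2Free xs → Hamming2Free ys → Hamming2Free (xs ++ ys)
Hamming2Free-++ {xs = xs} xs-even ys-odd xs-free ys-free {x} {y} x∈ y∈ with ∈-++⁻ xs x∈ | ∈-++⁻ xs y∈
... | inj₁ x∈xs | inj₁ y∈xs = xs-free x∈xs y∈xs
... | inj₂ x∈ys | inj₂ y∈ys = ys-free x∈ys y∈ys
... | inj₁ x∈xs | inj₂ y∈ys = λ x-y →
  All.lookup ys-odd y∈ys (hamming≡2⇒Even x y x-y (All.lookup xs-even x∈xs))
... | inj₂ x∈ys | inj₁ y∈xs = λ x-y →
  All.lookup ys-odd x∈ys (hamming≡2⇒Even y x (trans (hamming-sym y x) x-y) (All.lookup xs-even y∈xs))

step-avoiding : {M : List (Vec Bool h)} → Hamming2Free M →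
                (u v : Vec Bool h) → hamming u v ≡ suc (suc k) →
                Σ (Vec Bool h) λ w → hamming u w ≡ 1 × hamming w v ≡ suc k × w ∉ M
step-avoiding {M = M} M-free u v u-v with two-steps-towards u v u-v
... | w₁ , w₂ , (u-w₁ , w₁-v) , (u-w₂ , w₂-v) , w₁-w₂
  with DecMembership._∈?_ (≡-dec Bool._≟_) w₁ M | DecMembership._∈?_ (≡-dec Bool._≟_) w₂ M
... | yes w₁∈M | yes w₂∈M = contradiction w₁-w₂ (M-free w₁∈M w₂∈M)
... | no w₁∉M  | _        = w₁ , u-w₁ , w₁-v , w₁∉M
... | yes _    | no w₂∉M  = w₂ , u-w₂ , w₂-v , w₂∉M

free-geodesic : {M : List (Vec Bool h)} → Hamming2Free M → ∀ k (u v : Vec Bool h) →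
                hamming u v ≡ k → FreeWalk (Q h) M u v k
free-geodesic _ zero u v u-v with hamming≡0⇒≡ u v u-v
... | refl = [] , refl , λ _ ()
free-geodesic _ 1 u v u-v = u-v ∷ [] , refl , λ { _ (there _ _ ()) }
free-geodesic M-free (suc (suc k)) u v u-v =
  let w , u-w , w-v , w∉M = step-avoiding M-free u v u-v
  in FreeWalk-∷ _ _ u-w w∉M (free-geodesic M-free (suc k) w v w-v)

geodesic : (u v : Vec Bool h) → hamming u v ≡ n → Σ (Walk (Q h) u v) λ p → walkLength (Q h) p ≡ n
geodesic u v u-v = let p , length≡ , _ = free-geodesic {M = []} (λ ()) _ u v u-v in p , length≡

hamming≤walkLength : {u v : Vec Bool h} (p : Walk (Q h) u v) → hamming u v ≤ walkLength (Q h) p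
hamming≤walkLength {u = u} []                      = ≤-reflexive (hamming-refl u)
hamming≤walkLength {u = u} {v} (_∷_ {w = w} u-w p) = begin
  hamming u v                 ≤⟨ hamming-triangle u w v ⟩
  hamming u w + hamming w v   ≡⟨ cong (_+ hamming w v) u-w ⟩
  suc (hamming w v)           ≤⟨ s≤s (hamming≤walkLength p) ⟩
  suc (walkLength (Q _) p)    ∎
  where open ≤-Reasoning

walkLength≡hamming⇒IsShortest : {u v : Vec Bool h} (p : Walk (Q h) u v) →
                                walkLength (Q h) p ≡ hamming u v → IsShortest (Q h) p
walkLength≡hamming⇒IsShortest p length≡ q =
  subst (_≤ walkLength (Q _) q) (sym length≡) (hamming≤walkLength q)

IsShortest⇒walkLength≡hamming : {u v : Vec Bool h} (p : Walk (Q h) u v) →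
                                IsShortest (Q h) p → walkLength (Q h) p ≡ hamming u v
IsShortest⇒walkLength≡hamming {u = u} {v} p shortest =
  let q , length≡ = geodesic u v refl
  in ≤-antisym (subst (walkLength (Q _) p ≤_) length≡ (shortest q)) (hamming≤walkLength p)

Dist⇒hamming≡ : {u v : Vec Bool h} → Dist (Q h) u v n → hamming u v ≡ n
Dist⇒hamming≡ (p , shortest , length≡) = trans (sym (IsShortest⇒walkLength≡hamming p shortest)) length≡

hamming≡⇒Dist : (u v : Vec Bool h) → hamming u v ≡ n → Dist (Q h) u v n
hamming≡⇒Dist u v u-v =
  let p , length≡ = geodesic u v u-v
  in p , walkLength≡hamming⇒IsShortest p (trans length≡ (sym u-v)) , length≡

Hamming2Free⇒visible : {M : List (Vec Bool h)} → Hamming2Free M → ∀ u v → MVisible (Q h) M u v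
Hamming2Free⇒visible M-free u v =
  let p , length≡ , p-free = free-geodesic M-free _ u v refl
  in p , walkLength≡hamming⇒IsShortest p length≡ , p-free

visible⇒Hamming2Free : {M : List (Vec Bool h)} → (∀ u v → MVisible (Q h) M u v) → Hamming2Free M
visible⇒Hamming2Free {M = M} visible {x} {y} x∈M y∈M x-y with other-diagonal x y x-y
... | u , v , u-v , common with visible u v
... | p , shortest , p-free = blocked p (trans (IsShortest⇒walkLength≡hamming p shortest) u-v) p-free
  where
  blocked : (p : Walk (Q _) u v) → walkLength (Q _) p ≡ 2 → MFree (Q _) M p → ⊥
  blocked (_∷_ {w = w} u-w (w-v ∷ [])) _ p-free
    with p-free w (here u-w w-v []) (Sum.[ (λ { refl → x∈M }) , (λ { refl → y∈M }) ] (common w u-w w-v))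
  ... | inj₁ refl = contradiction (trans (sym (hamming-refl w)) u-w) λ ()
  ... | inj₂ refl = contradiction (trans (sym (hamming-refl w)) w-v) λ ()

allVectors : ∀ h → List (Vec Bool h)
allVectors zero    = [ [] ]
allVectors (suc h) = cartesianProductWith _∷_ (true ∷ false ∷ []) (allVectors h)

∈-allVectors : (x : Vec Bool h) → x ∈ allVectors h
∈-allVectors []          = here refl
∈-allVectors (true ∷ x)  =
  ∈-cartesianProductWith⁺ _∷_ {xs = true ∷ false ∷ []} (here refl) (∈-allVectors x)
∈-allVectors (false ∷ x) =
  ∈-cartesianProductWith⁺ _∷_ {xs = true ∷ false ∷ []} (there (here refl)) (∈-allVectors x)

allVectors-unique : ∀ h → Unique (allVectors h)
allVectors-unique zero    = All.[] ∷ []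
allVectors-unique (suc h) =
  Unique.cartesianProductWith⁺ _∷_ ∷-injective (((λ ()) All.∷ All.[]) ∷ All.[] ∷ []) (allVectors-unique h)

IsEvenCode : List (Vec Bool h) → Set
IsEvenCode xs = All Even xs × Unique xs × Hamming2Free xs

IsEvenCode? : (xs : List (Vec Bool h)) → Dec (IsEvenCode xs)
IsEvenCode? xs = all? Even? xs ×-dec unique? (≡-dec Bool._≟_) xs ×-dec Hamming2Free? xs

IsEvenCode-hereditary : {xs ys : List (Vec Bool h)} → Unique ys → ys ⊆ xs → IsEvenCode xs → IsEvenCode ys
IsEvenCode-hereditary ys-unique ys⊆xs (xs-even , _ , xs-free) =
  All.tabulate (All.lookup xs-even ∘ ys⊆xs) , ys-unique , Hamming2Free-⊆ ys⊆xs xs-free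

map-proj₁-toList : {A : Set} {P : A → Set} {xs : List A} (pxs : All P xs) → map proj₁ (All.toList pxs) ≡ xs
map-proj₁-toList All.[]          = refl
map-proj₁-toList (px All.∷ pxs) = cong (_ ∷_) (map-proj₁-toList pxs)

IsEvenCode⇒IsIndependent : {xs : List (Vec Bool h)} → IsEvenCode xs →
                           Σ (List (Graph.V (Q' h))) λ I → IsIndependent (Q' h) I × length I ≡ length xs
IsEvenCode⇒IsIndependent {xs = xs} (xs-even , xs-unique , xs-free) =
  I , (Unique.map⁻ (subst Unique (sym proj₁-I≡xs) xs-unique) , independent) ,
  trans (sym (length-map proj₁ I)) (cong length proj₁-I≡xs)
  where
  I : List (Graph.V (Q' _))
  I = All.toList xs-even
  proj₁-I≡xs : map proj₁ I ≡ xs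
  proj₁-I≡xs = map-proj₁-toList xs-even
  ∈xs : ∀ {p} → p ∈ I → proj₁ p ∈ xs
  ∈xs p∈I = subst (_ ∈_) proj₁-I≡xs (∈-map⁺ proj₁ p∈I)
  independent : ∀ p q → p ∈ I → q ∈ I → ¬ Dist (Q _) (proj₁ p) (proj₁ q) 2
  independent p q p∈I q∈I = xs-free (∈xs p∈I) (∈xs q∈I) ∘ Dist⇒hamming≡

IsIndependent⇒IsEvenCode : {I : List (Graph.V (Q' h))} → IsIndependent (Q' h) I → IsEvenCode (map proj₁ I)
IsIndependent⇒IsEvenCode {I = I} (I-unique , independent) =
  All.fromList I , Unique.map⁺ proj₁-injective I-unique , free
  where
  proj₁-injective : ∀ {p q : Graph.V (Q' _)} → proj₁ p ≡ proj₁ q → p ≡ q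
  proj₁-injective {_ , e} {_ , e′} refl = cong (_ ,_) (≡-irrelevant e e′)
  free : Hamming2Free (map proj₁ I)
  free x∈ y∈ with ∈-map⁻ proj₁ x∈ | ∈-map⁻ proj₁ y∈
  ... | p , p∈I , refl | q , q∈I , refl = independent p q p∈I q∈I ∘ hamming≡⇒Dist _ _

α-exists : ∀ h → Σ ℕ (IsAlpha (Q' h))
α-exists h with maxSize (≡-dec Bool._≟_) ∈-allVectors (allVectors-unique h)
                  IsEvenCode? (All.[] , [] , λ ()) IsEvenCode-hereditary (proj₁ ∘ proj₂)
... | a , (C , C-code , |C|≡a) , C-maximum =
  let I , I-independent , |I|≡|C| = IsEvenCode⇒IsIndependent C-code
  in a , (I , I-independent , trans |I|≡|C| |C|≡a) , λ J J-independent →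
       subst (_≤ a) (length-map proj₁ J) (C-maximum (map proj₁ J) (IsIndependent⇒IsEvenCode J-independent))

IsEvenCode⇒≤α : ∀ {a} {xs : List (Vec Bool h)} → IsAlpha (Q' h) a → IsEvenCode xs → length xs ≤ a
IsEvenCode⇒≤α {a = a} (_ , maximum) xs-code =
  let I , I-independent , |I|≡|xs| = IsEvenCode⇒IsIndependent xs-code
  in subst (_≤ a) |I|≡|xs| (maximum I I-independent)

double : List (Vec Bool (suc h)) → List (Vec Bool (suc h))
double E = E ++ map flipHead E

length-double : (E : List (Vec Bool (suc h))) → length (double E) ≡ 2 * length E
length-double E = begin
  length (E ++ map flipHead E)          ≡⟨ length-++ E ⟩
  length E + length (map flipHead E)    ≡⟨ cong (length E +_) (length-map flipHead E) ⟩
  length E + length E                   ≡⟨ cong (length E +_) (+-identityʳ (length E)) ⟨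
  2 * length E                          ∎
  where open ≡-Reasoning

double-IsTotalMVSet : {E : List (Vec Bool (suc h))} → IsEvenCode E → IsTotalMVSet (Q (suc h)) (double E)
double-IsTotalMVSet {E = E} (E-even , E-unique , E-free) =
  Unique.++⁺ E-unique (Unique.map⁺ flipHead-injective E-unique) disjoint ,
  Hamming2Free⇒visible
    (Hamming2Free-++ E-even flipped-odd E-free (Hamming2Free-map hamming-flipHead E-free))
  where
  flipped-odd : All (¬_ ∘ Even) (map flipHead E)
  flipped-odd = All.gmap⁺ {f = flipHead} (λ {x} → Even⇒¬Even-flipHead {x = x}) E-even
  disjoint : Disjoint E (map flipHead E)
  disjoint (x∈E , x∈flipped) = All.lookup flipped-odd x∈flipped (All.lookup E-even x∈E)

IsTotalMVSet⇒length≤2α : ∀ {a} {S : List (Vec Bool (suc h))} → IsAlpha (Q' (suc h)) a →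
                         IsTotalMVSet (Q (suc h)) S → length S ≤ 2 * a
IsTotalMVSet⇒length≤2α {a = a} {S} α (S-unique , S-visible) = begin
  length S                                    ≡⟨ length-filter+length-filter-∁ Even? S ⟨
  length evens + length odds                  ≡⟨ cong (length evens +_) (length-map flipHead odds) ⟨
  length evens + length (map flipHead odds)   ≤⟨ +-mono-≤ (IsEvenCode⇒≤α α evens-code)
                                                          (IsEvenCode⇒≤α α flipped-odds-code) ⟩
  a + a                                       ≡⟨ cong (a +_) (+-identityʳ a) ⟨
  2 * a                                       ∎
  where
  open ≤-Reasoning
  evens odds : List (Vec Bool (suc _))
  evens = filter Even? S
  odds  = filter (∁? Even?) S
  S-free : Hamming2Free S
  S-free = visible⇒Hamming2Free S-visible
  evens-code : IsEvenCode evens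
  evens-code =
    All.all-filter Even? S ,
    Unique.filter⁺ Even? S-unique ,
    Hamming2Free-⊆ (filter-⊆ Even? S) S-free
  flipped-odds-code : IsEvenCode (map flipHead odds)
  flipped-odds-code =
    All.gmap⁺ {f = flipHead} (λ {x} → ¬Even⇒Even-flipHead {x = x}) (All.all-filter (∁? Even?) S) ,
    Unique.map⁺ flipHead-injective (Unique.filter⁺ (∁? Even?) S-unique) ,
    Hamming2Free-map hamming-flipHead (Hamming2Free-⊆ (filter-⊆ (∁? Even?) S) S-free)

proposition3p8 : (h : ℕ) → 1 ≤ h → Σ ℕ (λ a → IsAlpha (Q' h) a × IsMuT (Q h) (2 * a))
proposition3p8 (suc h) _ =
  let a , α = α-exists (suc h)
      (I , I-independent , |I|≡a) , _ = α
      E = map proj₁ I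
  in a , α ,
     (double E , double-IsTotalMVSet (IsIndependent⇒IsEvenCode I-independent) ,
      trans (length-double E) (cong (2 *_) (trans (length-map proj₁ I) |I|≡a))) ,
     λ _ → IsTotalMVSet⇒length≤2α α
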